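{- Let $m\in\mathcal{M}_N$ and $1\le i,j\le N+1$. Then $\mathrm{ins}_i(m)$ and $\mathrm{ins}_j(m)$ are Knuth-like equivalent.
   Context: A matching on a finite set $S\subseteq\mathbb{N}$ is a partition of $S$ into blocks of size 1 (unmatched vertex $(i)$) or 2 (chord $(i,j)$); $\mathcal{M}_N$ is the set of matchings on $[N]$. For $m\in\mathcal{M}_N$ and $1\le i\le N+1$, let $f_i:[N]\to[N+2]\setminus\{i,i+1\}$ be $f_i(j)=j$ for $j<i$ and $f_i(j)=j+2$ for $j\ge i$; $\mathrm{ins}_i(m)\in\mathcal{M}_{N+2}$ consists of the chords $(f_i(j_1),f_i(j_2))$ for chords $(j_1,j_2)$ of $m$, the chord $(i,i+1)$, and the unmatched vertices $(f_i(j))$ for unmatched vertices $(j)$ of $m$. Elementary Knuth-like transformations: (a) replace $(i,i+1),(i+2)$ by $(i),(i+1,i+2)$ or vice versa; (b) replace chords $(i,i+1),(i+2,j)$ (any $j$) by $(i,j),(i+1,i+2)$ or vice versa. Knuth-like equivalence is the equivalence relation generated by these transformations. -}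

module Defs where

open import Data.Nat using (ℕ; zero; suc; _+_; _∸_; _≤_; _<_; _<ᵇ_; _≡ᵇ_)
open import Data.Bool using (Bool; true; false; if_then_else_)
open import Data.Product using (_×_; Σ)
open import Data.Sum using (_⊎_)
open import Data.Empty using (⊥)
open import Relation.Binary.PropositionalEquality using (_≡_; _≢_)

-- A matching on [N] = {1,…,N} is encoded by its partner function p : ℕ → ℕ:
-- p x = y ≠ x means (x,y) is a chord, p x = x means (x) is unmatched.
-- Only the values on [N] matter.
InRange : ℕ → ℕ → Set
InRange N x = (1 ≤ x) × (x ≤ N)

record IsMatching (N : ℕ) (p : ℕ → ℕ) : Set where
  field
    closed : ∀ x → InRange N x → InRange N (p x)
    invol  : ∀ x → InRange N x → p (p x) ≡ x

f : ℕ → ℕ → ℕ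
f i y = if y <ᵇ i then y else y + 2

ins : ℕ → (ℕ → ℕ) → (ℕ → ℕ)
ins i p x =
  if x <ᵇ i then f i (p x)
  else if x ≡ᵇ i then suc i
  else if x ≡ᵇ suc i then i
  else f i (p (x ∸ 2))

Agree : ℕ → (ℕ → ℕ) → (ℕ → ℕ) → Set
Agree N p q = ∀ x → InRange N x → p x ≡ q x

AgreeExcept : ℕ → (ℕ → Set) → (ℕ → ℕ) → (ℕ → ℕ) → Set
AgreeExcept N S p q = ∀ x → InRange N x → (S x → ⊥) → p x ≡ q x

-- Transformation (a): (i,i+1),(i+2)  ↦  (i),(i+1,i+2)   (one direction;
-- the reverse direction is obtained via symmetry of the closure).
StepA : ℕ → (ℕ → ℕ) → (ℕ → ℕ) → Set
StepA N p q = Σ ℕ λ i →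
    InRange N i × InRange N (i + 2)
  × p i ≡ suc i × p (suc i) ≡ i × p (i + 2) ≡ i + 2
  × q i ≡ i × q (suc i) ≡ i + 2 × q (i + 2) ≡ suc i
  × AgreeExcept N (λ x → (x ≡ i) ⊎ (x ≡ suc i) ⊎ (x ≡ i + 2)) p q

StepB : ℕ → (ℕ → ℕ) → (ℕ → ℕ) → Set
StepB N p q = Σ ℕ λ i → Σ ℕ λ j →
    InRange N i × InRange N (i + 2) × InRange N j
  × j ≢ i × j ≢ suc i × j ≢ i + 2
  × p i ≡ suc i × p (suc i) ≡ i × p (i + 2) ≡ j × p j ≡ i + 2
  × q i ≡ j × q j ≡ i × q (suc i) ≡ i + 2 × q (i + 2) ≡ suc i
  × AgreeExcept N (λ x → (x ≡ i) ⊎ (x ≡ suc i) ⊎ (x ≡ i + 2) ⊎ (x ≡ j)) p q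

-- Knuth-like equivalence on matchings of [N]: the equivalence relation
-- generated by the elementary transformations (matchings being identified
-- when their partner functions agree on [N]).
data KnuthEquiv (N : ℕ) : (ℕ → ℕ) → (ℕ → ℕ) → Set where
  same  : ∀ {p q} → Agree N p q → KnuthEquiv N p q
  stepA : ∀ {p q} → StepA N p q → KnuthEquiv N p q
  stepB : ∀ {p q} → StepB N p q → KnuthEquiv N p q
  sym   : ∀ {p q} → KnuthEquiv N p q → KnuthEquiv N q p
  trans : ∀ {p q r} → KnuthEquiv N p q → KnuthEquiv N q r → KnuthEquiv N p r

-- Inserting the chord (i,i+1) at position i+1 instead of i only moves the
-- vertex coming from the old vertex i from i+2 to i.  If i was unmatched in m
-- this is transformation (a); if i was matched to k, the vertex f_i(k) is
-- re-attached from i+2 to i, which is transformation (b).  So consecutive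
-- insertions are equivalent, and a chain of such steps links any two.
module Submission where

open import Defs
open import Data.Nat using (ℕ; suc; _+_; _∸_; _≤_; _<_; _<ᵇ_; _≡ᵇ_; s≤s; z≤n; z<s; _≤′_; ≤′-refl; ≤′-step)
open import Data.Nat.Properties
open import Data.Bool using (true; false)
open import Data.Bool.Properties using (T-≡; ¬-not)
open import Data.Product using (Σ; _×_; _,_)
open import Data.Sum using (_⊎_; inj₁; inj₂)
open import Function using (_∘_)
open import Function.Bundles using (Equivalence)
open import Relation.Nullary using (¬_; yes; no; contradiction)
open import Relation.Binary using (tri<; tri≈; tri>)
open import Relation.Binary.PropositionalEquality as ≡
  using (_≡_; _≢_; refl; cong; subst; module ≡-Reasoning)

<ᵇ-true : ∀ {m n} → m < n → (m <ᵇ n) ≡ true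
<ᵇ-true m<n = Equivalence.to T-≡ (<⇒<ᵇ m<n)

<ᵇ-false : ∀ {m n} → ¬ m < n → (m <ᵇ n) ≡ false
<ᵇ-false {m} {n} m≮n = ¬-not (m≮n ∘ <ᵇ⇒< m n ∘ Equivalence.from T-≡)

≡ᵇ-refl : ∀ m → (m ≡ᵇ m) ≡ true
≡ᵇ-refl m = Equivalence.to T-≡ (≡⇒≡ᵇ m m refl)

≡ᵇ-false : ∀ {m n} → m ≢ n → (m ≡ᵇ n) ≡ false
≡ᵇ-false {m} {n} m≢n = ¬-not (m≢n ∘ ≡ᵇ⇒≡ m n ∘ Equivalence.from T-≡)

1+m<n+2 : ∀ {m n} → m ≤ n → suc m < n + 2
1+m<n+2 {m} {n} m≤n = subst (suc m <_) (+-comm 2 n) (s≤s (s≤s m≤n))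

f-< : ∀ {i y} → y < i → f i y ≡ y
f-< y<i rewrite <ᵇ-true y<i = refl

f-≥ : ∀ {i y} → i ≤ y → f i y ≡ y + 2
f-≥ i≤y rewrite <ᵇ-false (≤⇒≯ i≤y) = refl

f-self : ∀ i → f i i ≡ i + 2
f-self i = f-≥ ≤-refl

f-cases : ∀ i y → (y < i × f i y ≡ y) ⊎ (i ≤ y × f i y ≡ y + 2)
f-cases i y with y <? i
... | yes y<i = inj₁ (y<i , f-< y<i)
... | no  y≮i = inj₂ (≮⇒≥ y≮i , f-≥ (≮⇒≥ y≮i))

f-≢ : ∀ i y → f i y ≢ i
f-≢ i y with f-cases i y
... | inj₁ (y<i , fy≡y) = <⇒≢ y<i ∘ ≡.trans (≡.sym fy≡y)
... | inj₂ (i≤y , fy≡y+2) = >⇒≢ (<-trans (n<1+n i) (1+m<n+2 i≤y)) ∘ ≡.trans (≡.sym fy≡y+2)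

f-≢-suc : ∀ i y → f i y ≢ suc i
f-≢-suc i y with f-cases i y
... | inj₁ (y<i , fy≡y) = <⇒≢ (<-trans y<i (n<1+n i)) ∘ ≡.trans (≡.sym fy≡y)
... | inj₂ (i≤y , fy≡y+2) = >⇒≢ (1+m<n+2 i≤y) ∘ ≡.trans (≡.sym fy≡y+2)

f-suc : ∀ {i y} → y ≢ i → f i y ≡ f (suc i) y
f-suc {i} {y} y≢i with <-cmp y i
... | tri< y<i _ _ = ≡.trans (f-< y<i) (≡.sym (f-< (m<n⇒m<1+n y<i)))
... | tri≈ _ y≡i _ = contradiction y≡i y≢i
... | tri> _ _ i<y = ≡.trans (f-≥ (<⇒≤ i<y)) (≡.sym (f-≥ i<y))

f-injective : ∀ i {y z} → f i y ≡ f i z → y ≡ z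
f-injective i {y} {z} e with f-cases i y | f-cases i z
... | inj₁ (_ , fy) | inj₁ (_ , fz) = ≡.trans (≡.sym fy) (≡.trans e fz)
... | inj₂ (_ , fy) | inj₂ (_ , fz) = +-cancelʳ-≡ 2 y z (≡.trans (≡.sym fy) (≡.trans e fz))
... | inj₁ (y<i , fy) | inj₂ (i≤z , fz) =
  contradiction (≡.trans (≡.sym fy) (≡.trans e fz)) (<⇒≢ (<-trans (<-≤-trans y<i i≤z) (m<m+n z z<s)))
... | inj₂ (i≤y , fy) | inj₁ (z<i , fz) =
  contradiction (≡.trans (≡.sym fz) (≡.trans (≡.sym e) fy)) (<⇒≢ (<-trans (<-≤-trans z<i i≤y) (m<m+n y z<s)))

f≡+2⇒≡ : ∀ i {y} → f i y ≡ i + 2 → y ≡ i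
f≡+2⇒≡ i fy≡i+2 = f-injective i (≡.trans fy≡i+2 (≡.sym (f-self i)))

f-preserves-InRange : ∀ {N} i {y} → InRange N y → InRange (N + 2) (f i y)
f-preserves-InRange {N} i {y} (1≤y , y≤N) with f-cases i y
... | inj₁ (_ , fy) = subst (InRange (N + 2)) (≡.sym fy) (1≤y , m≤n⇒m≤n+o 2 y≤N)
... | inj₂ (_ , fy) = subst (InRange (N + 2)) (≡.sym fy) (m≤n⇒m≤n+o 2 1≤y , +-monoˡ-≤ 2 y≤N)

f-preimage : ∀ {N i x} → 1 ≤ i → i ≤ N → InRange (N + 2) x → x ≢ i → x ≢ suc i →
             Σ ℕ λ y → InRange N y × f i y ≡ x
f-preimage {N} {i} {x} 1≤i i≤N (1≤x , x≤N+2) x≢i x≢1+i with <-cmp x i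
... | tri< x<i _ _ = x , (1≤x , ≤-trans (<⇒≤ x<i) i≤N) , f-< x<i
... | tri≈ _ x≡i _ = contradiction x≡i x≢i
... | tri> _ _ i<x = x ∸ 2 , (≤-trans 1≤i i≤x∸2 , x∸2≤N) , fx∸2≡x
  where
  2+i≤x : suc (suc i) ≤ x
  2+i≤x = ≤∧≢⇒< i<x (x≢1+i ∘ ≡.sym)
  i≤x∸2 : i ≤ x ∸ 2
  i≤x∸2 = ∸-monoˡ-≤ 2 2+i≤x
  x∸2≤N : x ∸ 2 ≤ N
  x∸2≤N = subst (x ∸ 2 ≤_) (m+n∸n≡m N 2) (∸-monoˡ-≤ 2 x≤N+2)
  fx∸2≡x : f i (x ∸ 2) ≡ x
  fx∸2≡x = ≡.trans (f-≥ i≤x∸2) (m∸n+n≡m (≤-trans (s≤s (s≤s z≤n)) 2+i≤x))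

ins-at : ∀ i p → ins i p i ≡ suc i
ins-at i p rewrite <ᵇ-false (n≮n i) | ≡ᵇ-refl i = refl

ins-at-suc : ∀ i p → ins i p (suc i) ≡ i
ins-at-suc i p rewrite <ᵇ-false (<⇒≯ (n<1+n i)) | ≡ᵇ-false (1+n≢n {i}) | ≡ᵇ-refl (suc i) = refl

ins-below : ∀ {i x} p → x < i → ins i p x ≡ f i (p x)
ins-below p x<i rewrite <ᵇ-true x<i = refl

ins-above : ∀ {i x} p → suc i < x → ins i p x ≡ f i (p (x ∸ 2))
ins-above p 1+i<x
  rewrite <ᵇ-false (<⇒≯ (<-trans (n<1+n _) 1+i<x))
        | ≡ᵇ-false (>⇒≢ (<-trans (n<1+n _) 1+i<x))
        | ≡ᵇ-false (>⇒≢ 1+i<x) = refl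

ins-f : ∀ i p y → ins i p (f i y) ≡ f i (p y)
ins-f i p y with f-cases i y
... | inj₁ (y<i , fy≡y) rewrite fy≡y = ins-below p y<i
... | inj₂ (i≤y , fy≡y+2) rewrite fy≡y+2 =
  ≡.trans (ins-above p (1+m<n+2 i≤y)) (cong (f i ∘ p) (m+n∸n≡m y 2))

ins-suc-f : ∀ i p {y} → y ≢ i → ins (suc i) p (f i y) ≡ f (suc i) (p y)
ins-suc-f i p {y} y≢i = ≡.trans (cong (ins (suc i) p) (f-suc y≢i)) (ins-f (suc i) p y)

ins-at-+2 : ∀ i p → ins i p (i + 2) ≡ f i (p i)
ins-at-+2 i p = ≡.trans (cong (ins i p) (≡.sym (f-self i))) (ins-f i p i)

ins-suc-at : ∀ i p → ins (suc i) p i ≡ f (suc i) (p i)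
ins-suc-at i p = ins-below p (n<1+n i)

ins-suc-at-suc : ∀ i p → ins (suc i) p (suc i) ≡ i + 2
ins-suc-at-suc i p = ≡.trans (ins-at (suc i) p) (+-comm 2 i)

ins-suc-at-+2 : ∀ i p → ins (suc i) p (i + 2) ≡ suc i
ins-suc-at-+2 i p rewrite +-comm i 2 = ins-at-suc (suc i) p

ins-suc-agree-on-f : ∀ i p {y} → y ≢ i → p y ≢ i → ins i p (f i y) ≡ ins (suc i) p (f i y)
ins-suc-agree-on-f i p {y} y≢i py≢i = begin
  ins i p (f i y)        ≡⟨ ins-f i p y ⟩
  f i (p y)              ≡⟨ f-suc py≢i ⟩
  f (suc i) (p y)        ≡⟨ ≡.sym (ins-suc-f i p y≢i) ⟩
  ins (suc i) p (f i y)  ∎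
  where open ≡-Reasoning

InRange-weaken : ∀ {N x} → InRange N x → InRange (N + 2) x
InRange-weaken (1≤x , x≤N) = 1≤x , m≤n⇒m≤n+o 2 x≤N

InRange-+2 : ∀ {N x} → InRange N x → InRange (N + 2) (x + 2)
InRange-+2 (1≤x , x≤N) = m≤n⇒m≤n+o 2 1≤x , +-monoˡ-≤ 2 x≤N

AgreeExcept-mono : ∀ {N} {S T : ℕ → Set} {p q} → (∀ x → S x → T x) →
                   AgreeExcept N S p q → AgreeExcept N T p q
AgreeExcept-mono S⊆T agree x x∈N x∉T = agree x x∈N (x∉T ∘ S⊆T x)

module _ {N p} (m : IsMatching N p) where
  open IsMatching m

  ins-suc-agree : ∀ {i} → 1 ≤ i → i ≤ N →
    AgreeExcept (N + 2) (λ x → (x ≡ i) ⊎ (x ≡ suc i) ⊎ (x ≡ i + 2) ⊎ (x ≡ f i (p i)))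
                (ins i p) (ins (suc i) p)
  ins-suc-agree {i} 1≤i i≤N x x∈N+2 x∉S
    with f-preimage 1≤i i≤N x∈N+2 (x∉S ∘ inj₁) (x∉S ∘ inj₂ ∘ inj₁)
  ... | y , y∈N , refl = ins-suc-agree-on-f i p y≢i py≢i
    where
    y≢i : y ≢ i
    y≢i refl = x∉S (inj₂ (inj₂ (inj₁ (f-self i))))
    py≢i : p y ≢ i
    py≢i py≡i = x∉S (inj₂ (inj₂ (inj₂ (cong (f i) (≡.trans (≡.sym (invol y y∈N)) (cong p py≡i))))))

  ins-suc-stepA : ∀ {i} → InRange N i → p i ≡ i → StepA (N + 2) (ins i p) (ins (suc i) p)
  ins-suc-stepA {i} i∈N@(1≤i , i≤N) pi≡i =
    i , InRange-weaken i∈N , InRange-+2 i∈N , ins-at i p , ins-at-suc i p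
      , ≡.trans (ins-at-+2 i p) fpi≡i+2
      , ≡.trans (ins-suc-at i p) (≡.trans (cong (f (suc i)) pi≡i) (f-< (n<1+n i)))
      , ins-suc-at-suc i p , ins-suc-at-+2 i p
      , AgreeExcept-mono forget-fpi (ins-suc-agree 1≤i i≤N)
    where
    fpi≡i+2 : f i (p i) ≡ i + 2
    fpi≡i+2 = ≡.trans (cong (f i) pi≡i) (f-self i)
    forget-fpi : ∀ x → (x ≡ i) ⊎ (x ≡ suc i) ⊎ (x ≡ i + 2) ⊎ (x ≡ f i (p i)) →
                 (x ≡ i) ⊎ (x ≡ suc i) ⊎ (x ≡ i + 2)
    forget-fpi x (inj₁ x≡i)                  = inj₁ x≡i
    forget-fpi x (inj₂ (inj₁ x≡1+i))         = inj₂ (inj₁ x≡1+i)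
    forget-fpi x (inj₂ (inj₂ (inj₁ x≡i+2)))  = inj₂ (inj₂ x≡i+2)
    forget-fpi x (inj₂ (inj₂ (inj₂ x≡fpi)))  = inj₂ (inj₂ (≡.trans x≡fpi fpi≡i+2))

  ins-suc-stepB : ∀ {i} → InRange N i → p i ≢ i → StepB (N + 2) (ins i p) (ins (suc i) p)
  ins-suc-stepB {i} i∈N@(1≤i , i≤N) pi≢i =
    i , f i (p i) , InRange-weaken i∈N , InRange-+2 i∈N , f-preserves-InRange i (closed i i∈N)
      , f-≢ i (p i) , f-≢-suc i (p i) , pi≢i ∘ f≡+2⇒≡ i
      , ins-at i p , ins-at-suc i p , ins-at-+2 i p
      , ≡.trans (ins-f i p (p i)) (≡.trans (cong (f i) (invol i i∈N)) (f-self i))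
      , ≡.trans (ins-suc-at i p) (≡.sym (f-suc pi≢i))
      , ≡.trans (ins-suc-f i p pi≢i) (≡.trans (cong (f (suc i)) (invol i i∈N)) (f-< (n<1+n i)))
      , ins-suc-at-suc i p , ins-suc-at-+2 i p
      , ins-suc-agree 1≤i i≤N

  ins-suc-equiv : ∀ {i} → InRange N i → KnuthEquiv (N + 2) (ins i p) (ins (suc i) p)
  ins-suc-equiv {i} i∈N with p i ≟ i
  ... | yes pi≡i = stepA (ins-suc-stepA i∈N pi≡i)
  ... | no  pi≢i = stepB (ins-suc-stepB i∈N pi≢i)

  ins-equiv-≤′ : ∀ {i j} → 1 ≤ i → i ≤′ j → j ≤ N + 1 → KnuthEquiv (N + 2) (ins i p) (ins j p)
  ins-equiv-≤′ _ ≤′-refl _ = same (λ _ _ → refl)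
  ins-equiv-≤′ 1≤i (≤′-step {j} i≤′j) 1+j≤N+1 =
    trans (ins-equiv-≤′ 1≤i i≤′j (m≤n⇒m≤n+o 1 j≤N))
          (ins-suc-equiv (≤-trans 1≤i (≤′⇒≤ i≤′j) , j≤N))
    where
    j≤N : j ≤ N
    j≤N = ≤-pred (subst (suc j ≤_) (+-comm N 1) 1+j≤N+1)

lemma5p6 : (N : ℕ) (p : ℕ → ℕ) → IsMatching N p →
           (i j : ℕ) → 1 ≤ i → i ≤ N + 1 → 1 ≤ j → j ≤ N + 1 →
           KnuthEquiv (N + 2) (ins i p) (ins j p)
lemma5p6 N p m i j 1≤i i≤N+1 1≤j j≤N+1 with ≤-total i j
... | inj₁ i≤j = ins-equiv-≤′ m 1≤i (≤⇒≤′ i≤j) j≤N+1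
... | inj₂ j≤i = sym (ins-equiv-≤′ m 1≤j (≤⇒≤′ j≤i) i≤N+1)
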